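{- Let $v_1,\ldots,v_a\in\mathbb{Z}_2^{\,m}$ where $m\ge 2^a$. Then there exists a non-zero vector $w\in\mathbb{Z}_2^{\,m}$ such that $w\cdot v_i=0$ for every $i\in[1,a]$ and the coordinates of $w$ equal to one occur in consecutive positions.
   Context: $\mathbb{Z}_2=\mathbb{Z}/2\mathbb{Z}$. For $x=(x_1,\ldots,x_m),y=(y_1,\ldots,y_m)\in\mathbb{Z}_2^{\,m}$, $x\cdot y=x_1y_1+\cdots+x_my_m\in\mathbb{Z}_2$. "Consecutive positions" means the set of indices $j$ with $w_j=1$ is a set of consecutive integers. -}

module Defs where

open import Data.Bool using (Bool; true; false; _xor_; _∧_)
open import Data.Nat using (ℕ; _≤_; _^_)
open import Data.Fin using (Fin; toℕ)
open import Data.Vec using (Vec; foldr; zipWith; lookup; replicate)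
open import Relation.Binary.PropositionalEquality using (_≡_)

-- Z₂ is modelled by Bool: addition = _xor_, multiplication = _∧_, 0 = false, 1 = true.
Z2Vec : ℕ → Set
Z2Vec m = Vec Bool m

_·_ : {m : ℕ} → Z2Vec m → Z2Vec m → Bool
x · y = foldr (λ _ → Bool) _xor_ false (zipWith _∧_ x y)

zeroVec : (m : ℕ) → Z2Vec m
zeroVec m = replicate m false

ConsecutiveOnes : {m : ℕ} → Z2Vec m → Set
ConsecutiveOnes {m} w =
  (i j k : Fin m) → toℕ i ≤ toℕ k → toℕ k ≤ toℕ j →
  lookup w i ≡ true → lookup w j ≡ true → lookup w k ≡ true

{-# OPTIONS --safe #-}
-- Let p k ∈ Z₂^a record the dot products of the prefix indicator 1_{[0,k)} with v₁ … v_a.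
-- The m + 1 > 2^a values p 0, …, p m cannot all differ, so p j = p k for some j < k;
-- then the indicator of [j,k) = 1_{[0,k)} + 1_{[0,j)} is nonzero, consecutive and
-- orthogonal to every vᵢ by linearity of the dot product.
module Submission where

open import Defs
open import Algebra using (CommutativeRing)
open import Data.Bool using (Bool; true; false; _xor_; _∧_)
open import Data.Bool.Properties using (∧-distribʳ-xor; xor-same; xor-∧-commutativeRing)
open import Data.Fin using (Fin; toℕ; fromℕ<; funToFin; finToFun)
open import Data.Fin.Properties using (pigeonhole; toℕ<n; toℕ-fromℕ<; finToFun-funToFin; 2↔Bool)
open import Data.Nat using (ℕ; _≤_; _<_; _^_; s≤s; s≤s⁻¹; _<?_)
open import Data.Nat.Properties using (≤-refl; ≤-trans; n≮n; ≤-<-trans; <-≤-trans; ≮⇒≥; <⇒≤)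
open import Data.Product using (Σ; _×_; _,_; proj₁; proj₂; ∃₂)
open import Data.Vec using ([]; _∷_; lookup; tabulate; zipWith)
open import Data.Vec.Properties using (lookup∘tabulate; lookup-zipWith; lookup-replicate)
open import Function using (_∘_; Inverse)
open import Relation.Binary.PropositionalEquality
  using (_≡_; _≢_; _≗_; refl; sym; cong; cong₂; module ≡-Reasoning)
open import Relation.Nullary using (¬_; yes; no; contradiction)
open import Relation.Nullary.Decidable using (⌊_⌋)

open import Algebra.Properties.CommutativeSemigroup
  (CommutativeRing.+-commutativeSemigroup xor-∧-commutativeRing) using (interchange)

open ≡-Reasoning

·-distribʳ-xor : {m : ℕ} (x y z : Z2Vec m) → zipWith _xor_ x y · z ≡ (x · z) xor (y · z)
·-distribʳ-xor []       []       []       = refl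
·-distribʳ-xor (x ∷ xs) (y ∷ ys) (z ∷ zs) = begin
  ((x xor y) ∧ z) xor (zipWith _xor_ xs ys · zs)
    ≡⟨ cong₂ _xor_ (∧-distribʳ-xor z x y) (·-distribʳ-xor xs ys zs) ⟩
  ((x ∧ z) xor (y ∧ z)) xor ((xs · zs) xor (ys · zs))
    ≡⟨ interchange (x ∧ z) (y ∧ z) (xs · zs) (ys · zs) ⟩
  ((x ∧ z) xor (xs · zs)) xor ((y ∧ z) xor (ys · zs)) ∎

prefix : (m k : ℕ) → Z2Vec m
prefix m k = tabulate (λ t → ⌊ toℕ t <? k ⌋)

block : (m j k : ℕ) → Z2Vec m
block m j k = zipWith _xor_ (prefix m k) (prefix m j)

lookup-block : ∀ {m} j k (t : Fin m) → lookup (block m j k) t ≡ ⌊ toℕ t <? k ⌋ xor ⌊ toℕ t <? j ⌋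
lookup-block {m} j k t = begin
  lookup (block m j k) t                           ≡⟨ lookup-zipWith _xor_ t (prefix m k) (prefix m j) ⟩
  lookup (prefix m k) t xor lookup (prefix m j) t  ≡⟨ cong₂ _xor_ (lookup∘tabulate _ t) (lookup∘tabulate _ t) ⟩
  ⌊ toℕ t <? k ⌋ xor ⌊ toℕ t <? j ⌋               ∎

between⇒lookup-block≡true : ∀ {m j k} (t : Fin m) → j ≤ toℕ t → toℕ t < k →
                            lookup (block m j k) t ≡ true
between⇒lookup-block≡true {j = j} {k} t j≤t t<k
  rewrite lookup-block j k t with toℕ t <? j | toℕ t <? k
... | yes t<j | _      = contradiction (≤-<-trans j≤t t<j) (n≮n j)
... | no _    | yes _  = refl
... | no _    | no t≮k = contradiction t<k t≮k

lookup-block≡true⇒between : ∀ {m j k} (t : Fin m) → j ≤ k → lookup (block m j k) t ≡ true →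
                            j ≤ toℕ t × toℕ t < k
lookup-block≡true⇒between {j = j} {k} t j≤k one
  rewrite lookup-block j k t with toℕ t <? j | toℕ t <? k | one
... | yes t<j | no t≮k  | _ = contradiction (<-≤-trans t<j j≤k) t≮k
... | no t≮j  | yes t<k | _ = ≮⇒≥ t≮j , t<k
... | yes _   | yes _   | ()
... | no _    | no _    | ()

block-nonzero : ∀ {m j k} → j < k → k ≤ m → block m j k ≢ zeroVec m
block-nonzero {m} {j} {k} j<k k≤m block≡0 = contradiction (begin
  true                   ≡⟨ sym (between⇒lookup-block≡true t j≤t t<k) ⟩
  lookup (block m j k) t ≡⟨ cong (λ w → lookup w t) block≡0 ⟩
  lookup (zeroVec m) t   ≡⟨ lookup-replicate t false ⟩
  false                  ∎) λ ()
  where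
  j<m : j < m
  j<m = <-≤-trans j<k k≤m
  t : Fin m
  t = fromℕ< j<m
  j≤t : j ≤ toℕ t
  j≤t rewrite toℕ-fromℕ< j<m = ≤-refl
  t<k : toℕ t < k
  t<k rewrite toℕ-fromℕ< j<m = j<k

block-consecutive : ∀ {m j k} → j ≤ k → ConsecutiveOnes (block m j k)
block-consecutive {j = j} {k} j≤k s u t s≤t t≤u one-at-s one-at-u =
  between⇒lookup-block≡true t (≤-trans j≤s s≤t) (≤-<-trans t≤u u<k)
  where
  j≤s : j ≤ toℕ s
  j≤s = proj₁ (lookup-block≡true⇒between s j≤k one-at-s)
  u<k : toℕ u < k
  u<k = proj₂ (lookup-block≡true⇒between u j≤k one-at-u)

block-orthogonal : ∀ {m} j k (z : Z2Vec m) → prefix m j · z ≡ prefix m k · z → block m j k · z ≡ false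
block-orthogonal {m} j k z same = begin
  block m j k · z                         ≡⟨ ·-distribʳ-xor (prefix m k) (prefix m j) z ⟩
  (prefix m k · z) xor (prefix m j · z)   ≡⟨ cong ((prefix m k · z) xor_) same ⟩
  (prefix m k · z) xor (prefix m k · z)   ≡⟨ xor-same (prefix m k · z) ⟩
  false                                   ∎

open Inverse 2↔Bool using (to; from; strictlyInverseˡ)

pigeonhole-Bool^ : ∀ {a n} → 2 ^ a < n → (f : Fin n → Fin a → Bool) →
                   ∃₂ λ i j → toℕ i < toℕ j × f i ≗ f j
pigeonhole-Bool^ 2^a<n f with pigeonhole 2^a<n (λ i → funToFin (from ∘ f i))
... | i , j , i<j , same = i , j , i<j , λ x → begin
  f i x                                   ≡⟨ sym (strictlyInverseˡ (f i x)) ⟩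
  to (from (f i x))                       ≡⟨ cong to (sym (finToFun-funToFin (from ∘ f i) x)) ⟩
  to (finToFun (funToFin (from ∘ f i)) x) ≡⟨ cong (λ c → to (finToFun c x)) same ⟩
  to (finToFun (funToFin (from ∘ f j)) x) ≡⟨ cong to (finToFun-funToFin (from ∘ f j) x) ⟩
  to (from (f j x))                       ≡⟨ strictlyInverseˡ (f j x) ⟩
  f j x                                   ∎

mainTheorem15 : (a m : ℕ) → 2 ^ a ≤ m → (v : Fin a → Z2Vec m) →
    Σ (Z2Vec m) (λ w → (¬ (w ≡ zeroVec m)) × ((i : Fin a) → w · v i ≡ false) × ConsecutiveOnes w)
mainTheorem15 a m 2^a≤m v with pigeonhole-Bool^ (s≤s 2^a≤m) (λ k i → prefix m (toℕ k) · v i)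
... | j , k , j<k , same-signature =
  block m (toℕ j) (toℕ k) ,
  block-nonzero j<k (s≤s⁻¹ (toℕ<n k)) ,
  (λ i → block-orthogonal (toℕ j) (toℕ k) (v i) (same-signature i)) ,
  block-consecutive (<⇒≤ j<k)
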